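{- Let $s,t$ be coprime positive integers and let $A=(A_{i,j})$ be the array with rows $1\le i\le \lfloor s/2\rfloor$ and columns $1\le j\le \lfloor t/2\rfloor$ given by $A_{i,j}=st-(2j-1)s-(2i-1)t$. For every lattice path $P\in\mathcal{P}(A)$, \[ |\Phi(P)| \;=\; \frac{(s^2-1)(t^2-1)}{24} \;-\; \sum_{(i,j)\text{ above }P} A_{i,j}. \]
   Context: The array $A$ is drawn as a rectangular grid of cells, row $i$ being the $i$-th row from the top and column $j$ the $j$-th column from the left. $\mathcal{P}(A)$ denotes the set of lattice paths along the grid lines from the lower-left corner to the upper-right corner of this rectangle using unit steps up and right; each cell of $A$ lies either above (on the upper-left side of) or below $P$. For $P\in\mathcal{P}(A)$, $M_A(P)$ is the set consisting of the positive entries $A_{i,j}$ in cells below $P$ together with the absolute values $|A_{i,j}|$ of the negative entries in cells above $P$. A self-conjugate partition is uniquely determined by the set of hook lengths of the cells on its main diagonal (hook length of a cell = number of cells to its right in its row plus number below it in its column plus one). It is known (Ford–Mai–Sze) that for coprime $s,t$, for each $P\in\mathcal{P}(A)$ there is a unique self-conjugate partition $\Phi(P)$ whose set of main diagonal hook lengths equals $M_A(P)$, that $\Phi(P)$ is an $(s,t)$-core (simultaneously having no hook length equal to $s$ and none equal to $t$), and that $\Phi$ is a bijection from $\mathcal{P}(A)$ onto the set of self-conjugate $(s,t)$-core partitions. $|\lambda|$ denotes the size (sum of parts) of a partition $\lambda$. -}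

module Defs where

open import Data.Nat as ℕ using (ℕ; zero; suc; _<_; _≤_; _<ᵇ_; _≤ᵇ_)
open import Data.Nat.DivMod using (_/_)
open import Data.Integer as ℤ using (ℤ; +_; -[1+_])
open import Data.Bool using (Bool; true; false; if_then_else_; T)
open import Data.List using (List; []; _∷_; length; map; foldr; upTo; filter)
open import Data.Product using (Σ; _×_; ∃)
open import Data.Sum using (_⊎_)
open import Relation.Binary.PropositionalEquality using (_≡_)

data Decreasing : List ℕ → Set where
  dec-[] : Decreasing []
  dec-1  : ∀ {a} → Decreasing (a ∷ [])
  dec-∷  : ∀ {a b l} → b ≤ a → Decreasing (b ∷ l) → Decreasing (a ∷ b ∷ l)

data AllPositive : List ℕ → Set where
  pos-[] : AllPositive []
  pos-∷  : ∀ {a l} → 0 < a → AllPositive l → AllPositive (a ∷ l)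

IsPartition : List ℕ → Set
IsPartition λ′ = Decreasing λ′ × AllPositive λ′

-- r-th part (0-indexed), 0 beyond the length
part : List ℕ → ℕ → ℕ
part []      _       = 0
part (a ∷ _) zero    = a
part (_ ∷ l) (suc r) = part l r

size : List ℕ → ℕ
size = foldr ℕ._+_ 0

conj : List ℕ → List ℕ
conj λ′ = map (λ c → length (filter (λ a → c ℕ.<? a) λ′)) (upTo (part λ′ 0))

SelfConjugate : List ℕ → Set
SelfConjugate λ′ = conj λ′ ≡ λ′

-- hook length of cell (r,c) (0-indexed, row r, column c) of λ
hook : List ℕ → ℕ → ℕ → ℕ
hook λ′ r c = suc ((part λ′ r ℕ.∸ suc c) ℕ.+ (part (conj λ′) c ℕ.∸ suc r))

DiagHook : List ℕ → ℕ → Set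
DiagHook λ′ h = Σ ℕ λ r → (r < part λ′ r) × (hook λ′ r r ≡ h)

data Step : Set where
  up right : Step

countUp countRight : List Step → ℕ
countUp [] = 0
countUp (up ∷ p) = suc (countUp p)
countUp (right ∷ p) = countUp p
countRight [] = 0
countRight (up ∷ p) = countRight p
countRight (right ∷ p) = suc (countRight p)

-- path from lower-left to upper-right corner of the m × n rectangle
IsLatticePath : ℕ → ℕ → List Step → Set
IsLatticePath m n p = (countUp p ≡ m) × (countRight p ≡ n)

-- heights (number of up steps already taken) of the successive right steps
rightHeights : ℕ → List Step → List ℕ
rightHeights h [] = []
rightHeights h (up ∷ p) = rightHeights (suc h) p
rightHeights h (right ∷ p) = h ∷ rightHeights h p

-- cell (i,j) (1-indexed; row i from top, column j from left) of the
-- m-row grid lies above P iff the horizontal segment of P under column j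
-- is at height ≤ m - i, i.e.  i + height_j ≤ m.
above : ℕ → List Step → ℕ → ℕ → Bool
above m p i j = (i ℕ.+ part (rightHeights 0 p) (j ℕ.∸ 1)) ≤ᵇ m

rows cols : ℕ → ℕ
rows s = s / 2
cols t = t / 2

A : ℕ → ℕ → ℕ → ℕ → ℤ
A s t i j = + (s ℕ.* t) ℤ.- (+ (2 ℕ.* j ℕ.∸ 1) ℤ.* + s) ℤ.- (+ (2 ℕ.* i ℕ.∸ 1) ℤ.* + t)

InGrid : ℕ → ℕ → ℕ → ℕ → Set
InGrid m n i j = (1 ≤ i) × (i ≤ m) × (1 ≤ j) × (j ≤ n)

InM : ℕ → ℕ → List Step → ℕ → Set
InM s t p h = Σ ℕ λ i → Σ ℕ λ j → InGrid (rows s) (cols t) i j ×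
  ((T (above (rows s) p i j) × A s t i j ≡ -[1+ h ℕ.∸ 1 ] × 0 < h)
   ⊎ (T (Data.Bool.not (above (rows s) p i j)) × A s t i j ≡ + h × 0 < h))

sumℤ : List ℤ → ℤ
sumℤ = foldr ℤ._+_ (+ 0)

sumAbove : ℕ → ℕ → List Step → ℤ
sumAbove s t p = sumℤ (map (λ i → sumℤ (map (λ j →
    if above (rows s) p (suc i) (suc j) then A s t (suc i) (suc j) else + 0)
  (upTo (cols t)))) (upTo (rows s)))

module Submission where

open import Defs
open import Data.Nat using (ℕ; _<_; _*_)
open import Data.Nat.Coprimality using (Coprime)
open import Data.Integer as ℤ using (ℤ; +_; _-_)
open import Data.List using (List)
open import Function.Bundles using (_⇔_)
open import Relation.Binary.PropositionalEquality using (_≡_)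

open import Data.Nat using (zero; suc; _+_; _∸_; >-nonZero; _≤_; z≤n; s≤s; z<s; s<s; _<ᵇ_; _≤ᵇ_; _≡ᵇ_; _<?_; ⌊_/2⌋)
open import Data.Nat.Properties
open import Data.Nat.Divisibility using (_∣_; ∣-refl; ∣m∣n⇒∣m+n; ∣m+n∣m⇒∣n; n∣m*n; ∣⇒≤)
open import Data.Nat.DivMod using (_/_; m/n≡1+[m∸n]/n)
open import Data.Nat.Coprimality using (coprime-divisor)
import Data.Nat.Coprimality as Coprimality
import Data.Nat.Tactic.RingSolver as ℕ-Ring
import Data.Integer.Tactic.RingSolver as ℤ-Ring
open import Data.Integer using (-[1+_]; _⊖_)
import Data.Integer.Properties as ℤP
open import Data.Bool using (Bool; true; false; if_then_else_; T; not)
open import Data.Bool.Properties using (T-≡; T-not-≡)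
open import Data.List using ([]; _∷_; length; map; filter; applyUpTo)
open import Data.Product using (Σ; _×_; _,_; proj₁; proj₂)
open import Data.Sum using (_⊎_; inj₁; inj₂)
open import Data.Empty using (⊥-elim)
open import Data.Unit using (tt)
open import Function.Bundles using (Equivalence; mk⇔)
open import Relation.Binary using (tri<; tri≈; tri>)
open import Relation.Binary.PropositionalEquality
  using (refl; sym; trans; cong; cong₂; subst; subst₂; _≢_; ≢-sym; module ≡-Reasoning)
open import Relation.Nullary using (¬_; yes; no)

-- Call c(i,j) the contribution of cell (i,j) to M_A(P): |A_{i,j}|
-- when the cell lies below P with A_{i,j} > 0 or above P with A_{i,j} < 0,
-- and 0 otherwise.
--  1. |λ| is the sum of the diagonal hook lengths of the self-conjugate λ,
--     and distinct diagonal cells have distinct hook lengths.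
--  2. By coprimality of s and t distinct cells have distinct positive
--     contributions; as the diagonal hooks form the set M_A(P), counting
--     the multiplicity of each value on both sides gives |λ| = Σ c(i,j).
--  3. c = A⁺ - [above P]·A, so Σ c = F(s,t) - Σ_{above P} A, where
--     F(s,t) is the sum of the positive entries of A.
--  4. 24 F(s,t) = (s² - 1)(t² - 1) for coprime s, t, by induction on s + t
--     using how F changes under t ↦ t + 2s and t ↦ 2s - t.

∑ : ℕ → (ℕ → ℕ) → ℕ
∑ zero    f = 0
∑ (suc n) f = f 0 + ∑ n (λ i → f (suc i))

∑-cong : ∀ n {f g : ℕ → ℕ} → (∀ i → f i ≡ g i) → ∑ n f ≡ ∑ n g
∑-cong zero    eq = refl
∑-cong (suc n) eq = cong₂ _+_ (eq 0) (∑-cong n (λ i → eq (suc i)))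

∑-cong< : ∀ n {f g : ℕ → ℕ} → (∀ i → i < n → f i ≡ g i) → ∑ n f ≡ ∑ n g
∑-cong< zero    eq = refl
∑-cong< (suc n) eq = cong₂ _+_ (eq 0 z<s) (∑-cong< n (λ i i<n → eq (suc i) (s<s i<n)))

∑-zero : ∀ n {f : ℕ → ℕ} → (∀ i → i < n → f i ≡ 0) → ∑ n f ≡ 0
∑-zero zero    z = refl
∑-zero (suc n) z = cong₂ _+_ (z 0 z<s) (∑-zero n (λ i i<n → z (suc i) (s<s i<n)))

∑-+ : ∀ n (f g : ℕ → ℕ) → ∑ n (λ i → f i + g i) ≡ ∑ n f + ∑ n g
∑-+ zero    f g = refl
∑-+ (suc n) f g = begin
  f 0 + g 0 + ∑ n (λ i → f (suc i) + g (suc i))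
    ≡⟨ cong (λ r → f 0 + g 0 + r) (∑-+ n (λ i → f (suc i)) (λ i → g (suc i))) ⟩
  f 0 + g 0 + (∑ n (λ i → f (suc i)) + ∑ n (λ i → g (suc i)))
    ≡⟨ +-exchange (f 0) (g 0) _ _ ⟩
  f 0 + ∑ n (λ i → f (suc i)) + (g 0 + ∑ n (λ i → g (suc i))) ∎
  where
  open ≡-Reasoning
  +-exchange : ∀ a b c d → a + b + (c + d) ≡ a + c + (b + d)
  +-exchange = ℕ-Ring.solve-∀

∑-* : ∀ n k (f : ℕ → ℕ) → ∑ n (λ i → k * f i) ≡ k * ∑ n f
∑-* zero    k f = sym (*-zeroʳ k)
∑-* (suc n) k f = trans (cong (λ r → k * f 0 + r) (∑-* n k (λ i → f (suc i)))) (sym (*-distribˡ-+ k (f 0) _))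

∑-swap : ∀ m n (f : ℕ → ℕ → ℕ) → ∑ m (λ i → ∑ n (f i)) ≡ ∑ n (λ j → ∑ m (λ i → f i j))
∑-swap zero    n f = sym (∑-zero n (λ _ _ → refl))
∑-swap (suc m) n f = trans (cong (λ r → ∑ n (f 0) + r) (∑-swap m n (λ i → f (suc i))))
                           (sym (∑-+ n (f 0) _))

𝟙 : Bool → ℕ
𝟙 true  = 1
𝟙 false = 0

𝟙≤1 : ∀ b → 𝟙 b ≤ 1
𝟙≤1 true  = ≤-refl
𝟙≤1 false = z≤n

𝟙-pos : ∀ {b} → 0 < 𝟙 b → T b
𝟙-pos {true} _ = tt

T⇒𝟙-pos : ∀ {b} → T b → 0 < 𝟙 b
T⇒𝟙-pos {true} _ = z<s

mult : ℕ → (ℕ → ℕ) → ℕ → ℕ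
mult n f v = ∑ n (λ i → 𝟙 (f i ≡ᵇ v))

∑-pos⇒ : ∀ n (g : ℕ → ℕ) → 0 < ∑ n g → Σ ℕ λ i → i < n × 0 < g i
∑-pos⇒ (suc n) g p with g 0 in e
... | suc _ = 0 , z<s , subst (0 <_) (sym e) z<s
... | zero with ∑-pos⇒ n (λ i → g (suc i)) p
...   | i , i<n , q = suc i , s<s i<n , q

∑-pos : ∀ n (g : ℕ → ℕ) i → i < n → 0 < g i → 0 < ∑ n g
∑-pos (suc n) g zero    _         q = ≤-trans q (m≤m+n _ _)
∑-pos (suc n) g (suc i) (s≤s i<n) q = ≤-trans (∑-pos n (λ i → g (suc i)) i i<n q) (m≤n+m _ _)

mult-pos⇒ : ∀ n f v → 0 < mult n f v → Σ ℕ λ i → i < n × f i ≡ v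
mult-pos⇒ n f v p with ∑-pos⇒ n _ p
... | i , i<n , q = i , i<n , ≡ᵇ⇒≡ (f i) v (𝟙-pos q)

⇒mult-pos : ∀ n f v i → i < n → f i ≡ v → 0 < mult n f v
⇒mult-pos n f v i i<n refl = ∑-pos n _ i i<n (T⇒𝟙-pos (≡⇒≡ᵇ (f i) (f i) refl))

∑-atMostOne : ∀ n (g : ℕ → ℕ) → (∀ i → i < n → g i ≤ 1) →
  (∀ i i′ → i < n → i′ < n → 0 < g i → 0 < g i′ → i ≡ i′) → ∑ n g ≤ 1
∑-atMostOne zero    g ≤1 uniq = z≤n
∑-atMostOne (suc n) g ≤1 uniq with g 0 in e
... | zero = ∑-atMostOne n (λ i → g (suc i)) (λ i i<n → ≤1 (suc i) (s<s i<n))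
               (λ i i′ i<n i′<n p p′ → suc-injective (uniq (suc i) (suc i′) (s<s i<n) (s<s i′<n) p p′))
... | suc k = subst (_≤ 1) (sym (cong₂ _+_ k≡0 rest≡0)) ≤-refl
  where
  k≡0 : suc k ≡ 1
  k≡0 = ≤-antisym (subst (_≤ 1) e (≤1 0 z<s)) (s≤s z≤n)
  g0-pos : 0 < g 0
  g0-pos = subst (0 <_) (sym e) z<s
  rest≡0 : ∑ n (λ i → g (suc i)) ≡ 0
  rest≡0 = ∑-zero n (λ i i<n → n≤0⇒n≡0 (≮⇒≥ λ p →
             0≢1+n (uniq 0 (suc i) z<s (s<s i<n) g0-pos p)))

≤1-≡ : ∀ a b → a ≤ 1 → b ≤ 1 → (0 < a → 0 < b) → (0 < b → 0 < a) → a ≡ b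
≤1-≡ zero          zero          _         _         _  _  = refl
≤1-≡ zero          (suc b)       _         _         _  ba with ba z<s
... | ()
≤1-≡ (suc a)       zero          _         _         ab _  with ab z<s
... | ()
≤1-≡ (suc zero)    (suc zero)    _         _         _  _  = refl
≤1-≡ (suc (suc a)) _             (s≤s ())  _         _  _
≤1-≡ (suc zero)    (suc (suc b)) _         (s≤s ())  _  _

∑-value : ∀ N x → x < N → ∑ N (λ v → v * 𝟙 (x ≡ᵇ v)) ≡ x
∑-value (suc N) zero    _         = ∑-zero N (λ v _ → *-zeroʳ (suc v))
∑-value (suc N) (suc x) (s≤s x<N) =
  trans (∑-+ N (λ v → 𝟙 (x ≡ᵇ v)) (λ v → v * 𝟙 (x ≡ᵇ v)))
        (cong₂ _+_ (∑-one N x x<N) (∑-value N x x<N))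
  where
  ∑-one : ∀ N x → x < N → ∑ N (λ v → 𝟙 (x ≡ᵇ v)) ≡ 1
  ∑-one (suc N) zero    _         = cong suc (∑-zero N (λ _ _ → refl))
  ∑-one (suc N) (suc x) (s≤s x<N) = ∑-one N x x<N

∑-by-values : ∀ n N f → (∀ i → i < n → f i < N) → ∑ n f ≡ ∑ N (λ v → v * mult n f v)
∑-by-values n N f bound = begin
  ∑ n f                                   ≡⟨ ∑-cong< n (λ i i<n → sym (∑-value N (f i) (bound i i<n))) ⟩
  ∑ n (λ i → ∑ N (λ v → v * 𝟙 (f i ≡ᵇ v))) ≡⟨ ∑-swap n N (λ i v → v * 𝟙 (f i ≡ᵇ v)) ⟩
  ∑ N (λ v → ∑ n (λ i → v * 𝟙 (f i ≡ᵇ v))) ≡⟨ ∑-cong N (λ v → ∑-* n v _) ⟩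
  ∑ N (λ v → v * mult n f v)               ∎
  where open ≡-Reasoning

-- Self-conjugate partitions: size = sum of the diagonal hook lengths

<ᵇ-false : ∀ {m n} → n ≤ m → (m <ᵇ n) ≡ false
<ᵇ-false {m} {n} n≤m with m <ᵇ n in eq
... | false = refl
... | true  = ⊥-elim (<⇒≱ (<ᵇ⇒< m n (subst T (sym eq) tt)) n≤m)

<ᵇ-suc : ∀ r c → (r <ᵇ suc c) ≡ (r ≤ᵇ c)
<ᵇ-suc zero    c = refl
<ᵇ-suc (suc r) c = refl

∑𝟙≤ : ∀ n (q : ℕ → Bool) → ∑ n (λ i → 𝟙 (q i)) ≤ n
∑𝟙≤ zero    q = z≤n
∑𝟙≤ (suc n) q = +-mono-≤ (𝟙≤1 (q 0)) (∑𝟙≤ n (λ i → q (suc i)))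

𝟙-split : ∀ r c → 𝟙 (r ≤ᵇ c) + 𝟙 (c <ᵇ r) ≡ 1
𝟙-split zero    zero    = refl
𝟙-split zero    (suc c) = refl
𝟙-split (suc r) zero    = refl
𝟙-split (suc r) (suc c) rewrite <ᵇ-suc r c = 𝟙-split r c

count-interval : ∀ ℓ r x → x ≤ ℓ → ∑ ℓ (λ c → 𝟙 (c <ᵇ x) * 𝟙 (r ≤ᵇ c)) ≡ x ∸ r
count-interval zero    r       zero    _         = sym (0∸n≡0 r)
count-interval (suc ℓ) r       zero    _         = trans (∑-zero ℓ (λ _ _ → refl)) (sym (0∸n≡0 r))
count-interval (suc ℓ) zero    (suc x) (s≤s x≤ℓ) = cong suc (count-interval ℓ zero x x≤ℓ)
count-interval (suc ℓ) (suc r) (suc x) (s≤s x≤ℓ) =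
  trans (∑-cong ℓ (λ c → cong (λ b → 𝟙 (c <ᵇ x) * 𝟙 b) (<ᵇ-suc r c))) (count-interval ℓ r x x≤ℓ)

downClosed-count : ∀ ℓ (q : ℕ → Bool) → (∀ r → T (q (suc r)) → T (q r)) → (∀ r → ℓ ≤ r → q r ≡ false) →
  ∀ r → q r ≡ (r <ᵇ ∑ ℓ (λ i → 𝟙 (q i)))
downClosed-count zero    q down beyond r = beyond r z≤n
downClosed-count (suc ℓ) q down beyond r with q 0 in q0
... | false = trans (never r) (cong (r <ᵇ_) (sym (∑-zero ℓ (λ i _ → cong 𝟙 (never (suc i))))))
  where
  never : ∀ r → q r ≡ false
  never zero    = q0
  never (suc r) with q (suc r) in qr
  ... | false = refl
  ... | true  = ⊥-elim (subst T (never r) (down r (subst T (sym qr) tt)))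
... | true with r
...   | zero   = q0
...   | suc r′ = downClosed-count ℓ (λ i → q (suc i)) (λ i → down (suc i)) (λ i ℓ≤i → beyond (suc i) (s≤s ℓ≤i)) r′

part-beyond-length : ∀ l r → length l ≤ r → part l r ≡ 0
part-beyond-length []      r       _         = refl
part-beyond-length (a ∷ l) (suc r) (s≤s ℓ≤r) = part-beyond-length l r ℓ≤r

part-decreasing : ∀ {l} → Decreasing l → ∀ r → part l (suc r) ≤ part l r
part-decreasing dec-[]         r       = z≤n
part-decreasing dec-1          r       = z≤n
part-decreasing (dec-∷ b≤a d) zero    = b≤a
part-decreasing (dec-∷ b≤a d) (suc r) = part-decreasing d r

size≡∑part : ∀ l → size l ≡ ∑ (length l) (part l)
size≡∑part []      = refl
size≡∑part (a ∷ l) = cong (_+_ a) (size≡∑part l)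

count-exceeding : ∀ c l → length (filter (λ a → c <? a) l) ≡ ∑ (length l) (λ r → 𝟙 (c <ᵇ part l r))
count-exceeding c []      = refl
count-exceeding c (a ∷ l) with c <ᵇ a
... | true  = cong suc (count-exceeding c l)
... | false = count-exceeding c l

none-exceeding : ∀ {l} → Decreasing l → ∀ c → part l 0 ≤ c → length (filter (λ a → c <? a) l) ≡ 0
none-exceeding dec-[]              c _   = refl
none-exceeding (dec-1 {a})         c a≤c rewrite <ᵇ-false {c} {a} a≤c = refl
none-exceeding (dec-∷ {a} b≤a d)   c a≤c rewrite <ᵇ-false {c} {a} a≤c = none-exceeding d c (≤-trans b≤a a≤c)

part-applyUpTo : ∀ (g f : ℕ → ℕ) M c → part (map g (applyUpTo f M)) c ≡ (if c <ᵇ M then g (f c) else 0)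
part-applyUpTo g f zero    c       = refl
part-applyUpTo g f (suc M) zero    = refl
part-applyUpTo g f (suc M) (suc c) = part-applyUpTo g (λ x → f (suc x)) M c

module SelfConjugatePartition (lam : List ℕ) (dec : Decreasing lam) (sc : conj lam ≡ lam) where

  p : ℕ → ℕ
  p = part lam

  ℓ : ℕ
  ℓ = length lam

  p≡count : ∀ c → p c ≡ ∑ ℓ (λ r → 𝟙 (c <ᵇ p r))
  p≡count c = trans (trans (cong (λ μ → part μ c) (sym sc)) column) (count-exceeding c lam)
    where
    exceeding : ℕ
    exceeding = length (filter (λ a → c <? a) lam)
    column : part (conj lam) c ≡ exceeding
    column rewrite part-applyUpTo (λ c → length (filter (λ a → c <? a) lam)) (λ x → x) (p 0) c
      with c <ᵇ p 0 in c<p0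
    ... | true  = refl
    ... | false = sym (none-exceeding dec c (≮⇒≥ λ c<p0′ → subst T c<p0 (<⇒<ᵇ c<p0′)))

  p≤ℓ : ∀ r → p r ≤ ℓ
  p≤ℓ r = subst (_≤ ℓ) (sym (p≡count r)) (∑𝟙≤ ℓ (λ k → r <ᵇ p k))

  p-antitone : ∀ {r r′} → r ≤ r′ → p r′ ≤ p r
  p-antitone {r} r≤r′ with m≤n⇒∃[o]m+o≡n r≤r′
  ... | k , refl = go k
    where
    go : ∀ k → p (r + k) ≤ p r
    go zero    = ≤-reflexive (cong p (+-identityʳ r))
    go (suc k) = ≤-trans (≤-reflexive (cong p (+-suc r k))) (≤-trans (part-decreasing dec (r + k)) (go k))

  p-pos⇒<ℓ : ∀ r → 0 < p r → r < ℓ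
  p-pos⇒<ℓ r p-pos = ≰⇒> λ ℓ≤r → <⇒≢ p-pos (sym (part-beyond-length lam r ℓ≤r))

  p-symmetric : ∀ r c → (c <ᵇ p r) ≡ (r <ᵇ p c)
  p-symmetric r c = trans (downClosed-count ℓ (λ r → c <ᵇ p r) down beyond r) (cong (r <ᵇ_) (sym (p≡count c)))
    where
    down : ∀ r → T (c <ᵇ p (suc r)) → T (c <ᵇ p r)
    down r c<p = <⇒<ᵇ (<-≤-trans (<ᵇ⇒< c _ c<p) (part-decreasing dec r))
    beyond : ∀ r → ℓ ≤ r → (c <ᵇ p r) ≡ false
    beyond r ℓ≤r rewrite part-beyond-length lam r ℓ≤r = refl

  -- hook length of the diagonal cell (r, r), or 0 if there is none
  diagHook : ℕ → ℕ
  diagHook r = (p r ∸ r) + (p r ∸ suc r)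

  -- counting the cells on/right of the diagonal and, by symmetry, those below it
  size≡∑diagHook : size lam ≡ ∑ ℓ diagHook
  size≡∑diagHook = begin
    size lam
      ≡⟨ size≡∑part lam ⟩
    ∑ ℓ p
      ≡⟨ ∑-cong ℓ (λ r → sym (trans (∑-cong ℓ (λ c → sym (*-identityʳ _))) (count-interval ℓ 0 (p r) (p≤ℓ r)))) ⟩
    ∑ ℓ (λ r → ∑ ℓ (λ c → 𝟙 (c <ᵇ p r)))
      ≡⟨ ∑-cong ℓ (λ r → trans (∑-cong ℓ (λ c → split (c <ᵇ p r) r c)) (∑-+ ℓ _ _)) ⟩
    ∑ ℓ (λ r → onRight r + ∑ ℓ (λ c → 𝟙 (c <ᵇ p r) * 𝟙 (c <ᵇ r)))
      ≡⟨ ∑-+ ℓ onRight _ ⟩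
    ∑ ℓ onRight + ∑ ℓ (λ r → ∑ ℓ (λ c → 𝟙 (c <ᵇ p r) * 𝟙 (c <ᵇ r)))
      ≡⟨ cong (_+_ (∑ ℓ onRight)) below ⟩
    ∑ ℓ onRight + ∑ ℓ strictlyRight
      ≡⟨ sym (∑-+ ℓ onRight strictlyRight) ⟩
    ∑ ℓ (λ r → onRight r + strictlyRight r)
      ≡⟨ ∑-cong ℓ (λ r → cong₂ _+_ (count-interval ℓ r (p r) (p≤ℓ r)) (count-interval ℓ (suc r) (p r) (p≤ℓ r))) ⟩
    ∑ ℓ diagHook ∎
    where
    open ≡-Reasoning
    onRight strictlyRight : ℕ → ℕ
    onRight       r = ∑ ℓ (λ c → 𝟙 (c <ᵇ p r) * 𝟙 (r ≤ᵇ c))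
    strictlyRight r = ∑ ℓ (λ c → 𝟙 (c <ᵇ p r) * 𝟙 (suc r ≤ᵇ c))
    split : ∀ b r c → 𝟙 b ≡ 𝟙 b * 𝟙 (r ≤ᵇ c) + 𝟙 b * 𝟙 (c <ᵇ r)
    split b r c = sym (trans (sym (*-distribˡ-+ (𝟙 b) _ _)) (trans (cong (𝟙 b *_) (𝟙-split r c)) (*-identityʳ (𝟙 b))))
    below : ∑ ℓ (λ r → ∑ ℓ (λ c → 𝟙 (c <ᵇ p r) * 𝟙 (c <ᵇ r))) ≡ ∑ ℓ strictlyRight
    below = trans (∑-cong ℓ (λ r → ∑-cong ℓ (λ c → cong (λ b → 𝟙 b * 𝟙 (c <ᵇ r)) (p-symmetric r c))))
                  (∑-swap ℓ ℓ (λ r c → 𝟙 (r <ᵇ p c) * 𝟙 (c <ᵇ r)))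

  diagHook-hook : ∀ r → r < p r → diagHook r ≡ hook lam r r
  diagHook-hook r r<p = begin
    (p r ∸ r) + (p r ∸ suc r)              ≡⟨ cong (_+ (p r ∸ suc r)) (∸-suc r<p) ⟩
    suc ((p r ∸ suc r) + (p r ∸ suc r))    ≡⟨ cong (λ μ → suc ((p r ∸ suc r) + (part μ r ∸ suc r))) (sym sc) ⟩
    hook lam r r                           ∎
    where
    open ≡-Reasoning
    ∸-suc : ∀ {r x} → r < x → x ∸ r ≡ suc (x ∸ suc r)
    ∸-suc {zero}  {suc x} _         = refl
    ∸-suc {suc r} {suc x} (s≤s r<x) = ∸-suc r<x

  diagHook-off : ∀ r → ¬ (r < p r) → diagHook r ≡ 0
  diagHook-off r r≮p = cong₂ _+_ (m≤n⇒m∸n≡0 (≮⇒≥ r≮p)) (m≤n⇒m∸n≡0 (≤-trans (≮⇒≥ r≮p) (n≤1+n r)))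

  diagHook-decreasing : ∀ {r r′} → r < r′ → r′ < p r′ → diagHook r′ < diagHook r
  diagHook-decreasing {r} {r′} r<r′ r′<p = +-mono-<-≤ arm leg
    where
    p-r′≤p-r : p r′ ≤ p r
    p-r′≤p-r = p-antitone (<⇒≤ r<r′)
    arm : p r′ ∸ r′ < p r ∸ r
    arm = ≤-<-trans (∸-monoˡ-≤ r′ p-r′≤p-r) (∸-monoʳ-< r<r′ (≤-trans (<⇒≤ r′<p) p-r′≤p-r))
    leg : p r′ ∸ suc r′ ≤ p r ∸ suc r
    leg = ∸-mono p-r′≤p-r (s≤s (<⇒≤ r<r′))

  diagHook-injective : ∀ r r′ → r < p r → r′ < p r′ → diagHook r ≡ diagHook r′ → r ≡ r′
  diagHook-injective r r′ r<p r′<p eq with <-cmp r r′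
  ... | tri≈ _ r≡r′ _ = r≡r′
  ... | tri< r<r′ _ _ = ⊥-elim (<⇒≢ (diagHook-decreasing r<r′ r′<p) (sym eq))
  ... | tri> _ _ r′<r = ⊥-elim (<⇒≢ (diagHook-decreasing r′<r r<p) eq)

-- A_{i+1,j+1} = st - B s t i j
B : ℕ → ℕ → ℕ → ℕ → ℕ
B s t i j = suc (j + j) * s + suc (i + i) * t

-- F(s,t) = Σ A⁺_{i,j}, the sum of the positive entries of A
F : ℕ → ℕ → ℕ
F s t = ∑ ⌊ s /2⌋ (λ i → ∑ ⌊ t /2⌋ (λ j → s * t ∸ B s t i j))

-- The theorem's numerical core: 24 F(s,t) = (s² - 1)(t² - 1).
Identity : ℕ → ℕ → Set
Identity s t = 24 * F s t + s * s + t * t ≡ s * s * t * t + 1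

F-sym : ∀ s t → F s t ≡ F t s
F-sym s t = trans (∑-swap ⌊ s /2⌋ ⌊ t /2⌋ _)
  (∑-cong ⌊ t /2⌋ (λ j → ∑-cong ⌊ s /2⌋ (λ i → cong₂ _∸_ (*-comm s t) (+-comm (suc (j + j) * s) _))))

-- H s N X = Σ_{j<N} (X - (2j+1)s)⁺, computed by peeling off the first term
H : ℕ → ℕ → ℕ → ℕ
H s zero    X = 0
H s (suc N) X = (X ∸ s) + H s N (X ∸ (s + s))

H≡∑ : ∀ s N X → ∑ N (λ j → X ∸ suc (j + j) * s) ≡ H s N X
H≡∑ s zero    X = refl
H≡∑ s (suc N) X = cong₂ _+_ (cong (X ∸_) (+-identityʳ s))
  (trans (∑-cong N shift) (H≡∑ s N (X ∸ (s + s))))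
  where
  shift : ∀ j → X ∸ suc (suc j + suc j) * s ≡ (X ∸ (s + s)) ∸ suc (j + j) * s
  shift j = trans (cong (X ∸_) (trans (cong (λ z → suc z * s) (+-suc (suc j) j)) (expand s j)))
                  (sym (∸-+-assoc X (s + s) _))
    where
    expand : ∀ s j → suc (suc (suc (j + j))) * s ≡ (s + s) + suc (j + j) * s
    expand = ℕ-Ring.solve-∀

H-suc-stable : ∀ s N X → X ≤ s + N * (s + s) → H s (suc N) X ≡ H s N X
H-suc-stable s zero    X X≤s = cong (_+ 0) (m≤n⇒m∸n≡0 (subst (X ≤_) (+-identityʳ s) X≤s))
H-suc-stable s (suc N) X X≤  = cong (_+_ (X ∸ s)) (H-suc-stable s N (X ∸ (s + s)) X∸2s≤)
  where
  X∸2s≤ : X ∸ (s + s) ≤ s + N * (s + s)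
  X∸2s≤ = subst (X ∸ (s + s) ≤_) (trans (cong (_∸ (s + s)) (expand s N)) (m+n∸n≡m _ (s + s)))
            (∸-monoˡ-≤ (s + s) X≤)
    where
    expand : ∀ s N → s + suc N * (s + s) ≡ (s + N * (s + s)) + (s + s)
    expand = ℕ-Ring.solve-∀

H-extend : ∀ s k N X → X ≤ s + N * (s + s) → H s (k + N) X ≡ H s N X
H-extend s zero    N X _   = refl
H-extend s (suc k) N X X≤ =
  trans (H-suc-stable s (k + N) X (≤-trans X≤ (+-monoʳ-≤ s (*-monoˡ-≤ (s + s) (m≤n+m N k)))))
        (H-extend s k N X X≤)

H-stable : ∀ s N M X → X ≤ s + N * (s + s) → X ≤ s + M * (s + s) → H s N X ≡ H s M X
H-stable s N M X X≤N X≤M with ≤-total N M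
... | inj₁ N≤M = trans (sym (H-extend s (M ∸ N) N X X≤N)) (cong (λ K → H s K X) (m∸n+n≡m N≤M))
... | inj₂ M≤N = trans (cong (λ K → H s K X) (sym (m∸n+n≡m M≤N))) (H-extend s (N ∸ M) M X X≤M)

-- h s X = Σ_{j≥0} (X - (2j+1)s)⁺ for positive s (X terms always suffice)
h : ℕ → ℕ → ℕ
h s X = H s X X

enough-terms : ∀ s′ X → X ≤ suc s′ + X * (suc s′ + suc s′)
enough-terms s′ X = ≤-trans (m≤m*n X (suc s′ + suc s′)) (m≤n+m _ (suc s′))

h-small : ∀ s′ X → X ≤ suc s′ + suc s′ → h (suc s′) X ≡ X ∸ suc s′
h-small s′ X X≤2s = trans (H-stable s X 1 X (enough-terms s′ X) X≤) (+-identityʳ _)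
  where
  s : ℕ
  s = suc s′
  X≤ : X ≤ s + 1 * (s + s)
  X≤ = ≤-trans X≤2s (≤-trans (m≤n+m (s + s) s) (≤-reflexive (cong (_+_ s) (sym (*-identityˡ (s + s))))))

h-step : ∀ s′ X → h (suc s′) (X + (suc s′ + suc s′)) ≡ h (suc s′) X + X + suc s′
h-step s′ X = begin
  H s (X + (s + s)) (X + (s + s)) ≡⟨ H-stable s (X + (s + s)) (suc X) (X + (s + s)) (enough-terms s′ _) X+2s≤ ⟩
  H s (suc X) (X + (s + s))       ≡⟨ cong₂ _+_ X+2s∸s (cong (H s X) (m+n∸n≡m X (s + s))) ⟩
  (X + s) + H s X X               ≡⟨ rearrange X s (H s X X) ⟩
  H s X X + X + s                 ∎
  where
  open ≡-Reasoning
  s : ℕ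
  s = suc s′
  X+2s∸s : X + (s + s) ∸ s ≡ X + s
  X+2s∸s = trans (cong (_∸ s) (sym (+-assoc X s s))) (m+n∸n≡m (X + s) s)
  X+2s≤ : X + (s + s) ≤ s + suc X * (s + s)
  X+2s≤ = subst (X + (s + s) ≤_) (expand s X) (+-monoˡ-≤ (s + s) (≤-trans (m≤m*n X (s + s)) (m≤n+m _ s)))
    where
    expand : ∀ s X → s + X * (s + s) + (s + s) ≡ s + suc X * (s + s)
    expand = ℕ-Ring.solve-∀
  rearrange : ∀ X s b → X + s + b ≡ b + X + s
  rearrange = ℕ-Ring.solve-∀

h-shift : ∀ s′ c X → h (suc s′) (X + c * (suc s′ + suc s′)) ≡ h (suc s′) X + c * X + suc s′ * c * c
h-shift s′ zero    X = trans (cong (h (suc s′)) (+-identityʳ X)) (pad (h (suc s′) X) X s′)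
  where
  pad : ∀ a X s′ → a ≡ a + 0 * X + suc s′ * 0 * 0
  pad = ℕ-Ring.solve-∀
h-shift s′ (suc c) X = begin
  h s (X + (s + s + c * (s + s)))                   ≡⟨ cong (h s) (regroup X s c) ⟩
  h s ((X + c * (s + s)) + (s + s))                 ≡⟨ h-step s′ (X + c * (s + s)) ⟩
  h s (X + c * (s + s)) + (X + c * (s + s)) + s     ≡⟨ cong (λ z → z + (X + c * (s + s)) + s) (h-shift s′ c X) ⟩
  h s X + c * X + s * c * c + (X + c * (s + s)) + s ≡⟨ collect (h s X) X s c ⟩
  h s X + suc c * X + s * suc c * suc c             ∎
  where
  open ≡-Reasoning
  s : ℕ
  s = suc s′
  regroup : ∀ X s c → X + (s + s + c * (s + s)) ≡ (X + c * (s + s)) + (s + s)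
  regroup = ℕ-Ring.solve-∀
  collect : ∀ a X s c → a + c * X + s * c * c + (X + c * (s + s)) + s ≡ a + suc c * X + s * suc c * suc c
  collect = ℕ-Ring.solve-∀

∸-reflect : ∀ s X Y → X + Y ≡ s + s → (X ∸ s) + s ≡ (Y ∸ s) + X
∸-reflect s X Y X+Y≡2s with ≤-total s X
... | inj₁ s≤X with m≤n⇒∃[o]m+o≡n s≤X
...   | k , refl = begin
  (s + k ∸ s) + s   ≡⟨ cong (_+ s) (m+n∸m≡n s k) ⟩
  k + s             ≡⟨ +-comm k s ⟩
  s + k             ≡⟨ cong (_+ (s + k)) (sym (m≤n⇒m∸n≡0 Y≤s)) ⟩
  (Y ∸ s) + (s + k) ∎
  where
  open ≡-Reasoning
  Y≤s : Y ≤ s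
  Y≤s = subst (Y ≤_) (+-cancelˡ-≡ s _ _ (trans (sym (+-assoc s k Y)) X+Y≡2s)) (m≤n+m Y k)
∸-reflect s X Y X+Y≡2s | inj₂ X≤s with m≤n⇒∃[o]m+o≡n X≤s
...   | k , refl = begin
  (X ∸ (X + k)) + (X + k)     ≡⟨ cong (_+ (X + k)) (m≤n⇒m∸n≡0 (m≤m+n X k)) ⟩
  X + k                       ≡⟨ +-comm X k ⟩
  k + X                       ≡⟨ cong (_+ X) (sym (m+n∸n≡m k (X + k))) ⟩
  (k + (X + k) ∸ (X + k)) + X ≡⟨ cong (λ z → (z ∸ (X + k)) + X) (sym Y≡) ⟩
  (Y ∸ (X + k)) + X           ∎
  where
  open ≡-Reasoning
  Y≡ : Y ≡ k + (X + k)
  Y≡ = +-cancelˡ-≡ X _ _ (trans X+Y≡2s (regroup X k))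
    where
    regroup : ∀ X k → X + k + (X + k) ≡ X + (k + (X + k))
    regroup = ℕ-Ring.solve-∀

h-reflect : ∀ s′ c X Y → X + Y ≡ c * (suc s′ + suc s′) →
  h (suc s′) X + suc s′ * c * c ≡ h (suc s′) Y + c * X
h-reflect s′ zero X Y X+Y≡0 with m+n≡0⇒m≡0 X X+Y≡0 | m+n≡0⇒n≡0 X X+Y≡0
... | refl | refl = cong (_+_ 0) (*-zeroʳ (suc s′ * 0))
h-reflect s′ (suc c) X Y X+Y≡ with suc s′ + suc s′ ≤? X | suc s′ + suc s′ ≤? Y
... | yes 2s≤X | _ with m≤n⇒∃[o]m+o≡n 2s≤X
...   | X′ , refl = begin
  h s (s + s + X′) + s * suc c * suc c               ≡⟨ cong (λ z → h s z + s * suc c * suc c) (+-comm (s + s) X′) ⟩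
  h s (X′ + (s + s)) + s * suc c * suc c             ≡⟨ cong (_+ s * suc c * suc c) (h-step s′ X′) ⟩
  h s X′ + X′ + s + s * suc c * suc c                ≡⟨ split (h s X′) X′ s c ⟩
  (h s X′ + s * c * c) + (X′ + (s + s) + c * (s + s)) ≡⟨ cong (_+ (X′ + (s + s) + c * (s + s))) (h-reflect s′ c X′ Y X′+Y≡) ⟩
  (h s Y + c * X′) + (X′ + (s + s) + c * (s + s))    ≡⟨ collect (h s Y) X′ s c ⟩
  h s Y + suc c * (s + s + X′)                       ∎
  where
  open ≡-Reasoning
  s : ℕ
  s = suc s′
  X′+Y≡ : X′ + Y ≡ c * (s + s)
  X′+Y≡ = +-cancelˡ-≡ (s + s) _ _ (trans (sym (+-assoc (s + s) X′ Y)) X+Y≡)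
  split : ∀ a X′ s c → a + X′ + s + s * suc c * suc c ≡ (a + s * c * c) + (X′ + (s + s) + c * (s + s))
  split = ℕ-Ring.solve-∀
  collect : ∀ a X′ s c → (a + c * X′) + (X′ + (s + s) + c * (s + s)) ≡ a + suc c * (s + s + X′)
  collect = ℕ-Ring.solve-∀
h-reflect s′ (suc c) X Y X+Y≡ | no _ | yes 2s≤Y with m≤n⇒∃[o]m+o≡n 2s≤Y
...   | Y′ , refl = begin
  h s X + s * suc c * suc c            ≡⟨ split (h s X) s c ⟩
  (h s X + s * c * c) + (c * (s + s) + s) ≡⟨ cong₂ (λ a b → a + (b + s)) (h-reflect s′ c X Y′ X+Y′≡) (sym X+Y′≡) ⟩
  (h s Y′ + c * X) + ((X + Y′) + s)    ≡⟨ collect (h s Y′) X Y′ s c ⟩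
  h s Y′ + Y′ + s + suc c * X          ≡⟨ cong (_+ suc c * X) (sym (h-step s′ Y′)) ⟩
  h s (Y′ + (s + s)) + suc c * X       ≡⟨ cong (λ z → h s z + suc c * X) (+-comm Y′ (s + s)) ⟩
  h s (s + s + Y′) + suc c * X         ∎
  where
  open ≡-Reasoning
  s : ℕ
  s = suc s′
  X+Y′≡ : X + Y′ ≡ c * (s + s)
  X+Y′≡ = +-cancelˡ-≡ (s + s) _ _ (trans (regroup X (s + s) Y′) X+Y≡)
    where
    regroup : ∀ X a Y′ → a + (X + Y′) ≡ X + (a + Y′)
    regroup = ℕ-Ring.solve-∀
  split : ∀ a s c → a + s * suc c * suc c ≡ (a + s * c * c) + (c * (s + s) + s)
  split = ℕ-Ring.solve-∀
  collect : ∀ a X Y′ s c → (a + c * X) + ((X + Y′) + s) ≡ a + Y′ + s + suc c * X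
  collect = ℕ-Ring.solve-∀
h-reflect s′ (suc zero) X Y X+Y≡ | no 2s≰X | no 2s≰Y = begin
  h s X + s * 1 * 1 ≡⟨ cong₂ _+_ (h-small s′ X (<⇒≤ (≰⇒> 2s≰X))) (trans (*-identityʳ (s * 1)) (*-identityʳ s)) ⟩
  (X ∸ s) + s       ≡⟨ ∸-reflect s X Y (trans X+Y≡ (+-identityʳ _)) ⟩
  (Y ∸ s) + X       ≡⟨ cong₂ _+_ (sym (h-small s′ Y (<⇒≤ (≰⇒> 2s≰Y)))) (sym (+-identityʳ X)) ⟩
  h s Y + 1 * X     ∎
  where
  open ≡-Reasoning
  s : ℕ
  s = suc s′
h-reflect s′ (suc (suc c)) X Y X+Y≡ | no 2s≰X | no 2s≰Y =
  ⊥-elim (<⇒≱ (+-mono-< (≰⇒> 2s≰X) (≰⇒> 2s≰Y))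
           (subst (2s + 2s ≤_) (sym X+Y≡) (+-monoʳ-≤ 2s (m≤m+n 2s _))))
  where
  2s : ℕ
  2s = suc s′ + suc s′

gap : ℕ → ℕ → ℕ
gap s i = s ∸ suc (i + i)

Q : ℕ → ℕ
Q s = ∑ ⌊ s /2⌋ (λ i → gap s i * gap s i)

Q-formula : ∀ s → 6 * Q s + s ≡ s * s * s
Q-formula zero          = refl
Q-formula (suc zero)    = refl
Q-formula (suc (suc s)) = begin
  6 * (suc s * suc s + ∑ ⌊ s /2⌋ (λ i → gap (2 + s) (suc i) * gap (2 + s) (suc i))) + (2 + s)
    ≡⟨ cong (λ z → 6 * (suc s * suc s + z) + (2 + s)) (∑-cong ⌊ s /2⌋ gap-shift) ⟩
  6 * (suc s * suc s + Q s) + (2 + s)     ≡⟨ split (Q s) s ⟩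
  6 * (suc s * suc s) + 2 + (6 * Q s + s) ≡⟨ cong (λ z → 6 * (suc s * suc s) + 2 + z) (Q-formula s) ⟩
  6 * (suc s * suc s) + 2 + s * s * s     ≡⟨ cube s ⟩
  (2 + s) * (2 + s) * (2 + s)             ∎
  where
  open ≡-Reasoning
  gap-shift : ∀ i → gap (2 + s) (suc i) * gap (2 + s) (suc i) ≡ gap s i * gap s i
  gap-shift i = cong (λ z → (s ∸ z) * (s ∸ z)) (+-suc i i)
  split : ∀ q s → 6 * (suc s * suc s + q) + (2 + s) ≡ 6 * (suc s * suc s) + 2 + (6 * q + s)
  split = ℕ-Ring.solve-∀
  cube : ∀ s → 6 * (suc s * suc s) + 2 + s * s * s ≡ (2 + s) * (2 + s) * (2 + s)
  cube = ℕ-Ring.solve-∀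

⌊n/2⌋-bound : ∀ t → t ≤ suc (⌊ t /2⌋ + ⌊ t /2⌋)
⌊n/2⌋-bound zero          = z≤n
⌊n/2⌋-bound (suc zero)    = s≤s z≤n
⌊n/2⌋-bound (suc (suc t)) = s≤s (s≤s (subst (t ≤_) (sym (+-suc ⌊ t /2⌋ ⌊ t /2⌋)) (⌊n/2⌋-bound t)))

F-by-rows : ∀ s′ t → F (suc s′) t ≡ ∑ ⌊ suc s′ /2⌋ (λ i → h (suc s′) (t * gap (suc s′) i))
F-by-rows s′ t = ∑-cong ⌊ s /2⌋ row
  where
  s n : ℕ
  s = suc s′
  n = ⌊ t /2⌋
  row : ∀ i → ∑ n (λ j → s * t ∸ B s t i j) ≡ h s (t * gap s i)
  row i = trans (∑-cong n entry) (trans (H≡∑ s n X) (H-stable s n X X X≤ (enough-terms s′ X)))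
    where
    X : ℕ
    X = t * gap s i
    entry : ∀ j → s * t ∸ B s t i j ≡ X ∸ suc (j + j) * s
    entry j = begin
      s * t ∸ (suc (j + j) * s + suc (i + i) * t)   ≡⟨ cong (s * t ∸_) (+-comm (suc (j + j) * s) _) ⟩
      s * t ∸ (suc (i + i) * t + suc (j + j) * s)   ≡⟨ sym (∸-+-assoc (s * t) (suc (i + i) * t) _) ⟩
      (s * t ∸ suc (i + i) * t) ∸ suc (j + j) * s   ≡⟨ cong (_∸ suc (j + j) * s) (trans (sym (*-distribʳ-∸ t s (suc (i + i)))) (*-comm (gap s i) t)) ⟩
      X ∸ suc (j + j) * s                           ∎
      where open ≡-Reasoning
    X≤ : X ≤ s + n * (s + s)
    X≤ = ≤-trans (*-monoʳ-≤ t (m∸n≤m s (suc (i + i)))) (≤-trans (*-monoˡ-≤ s (⌊n/2⌋-bound t)) (≤-reflexive (expand s n)))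
      where
      expand : ∀ s n → suc (n + n) * s ≡ s + n * (s + s)
      expand = ℕ-Ring.solve-∀

F-shift : ∀ s t → 0 < s → F s (t + (s + s)) ≡ F s t + (t + s) * Q s
F-shift (suc s′) t _ = begin
  F s (t + (s + s))                                          ≡⟨ F-by-rows s′ (t + (s + s)) ⟩
  ∑ m (λ i → h s ((t + (s + s)) * gap s i))                  ≡⟨ ∑-cong m (λ i → shift (gap s i)) ⟩
  ∑ m (λ i → h s (t * gap s i) + (t + s) * (gap s i * gap s i)) ≡⟨ ∑-+ m _ _ ⟩
  ∑ m (λ i → h s (t * gap s i)) + ∑ m (λ i → (t + s) * (gap s i * gap s i))
    ≡⟨ cong₂ _+_ (sym (F-by-rows s′ t)) (∑-* m (t + s) _) ⟩
  F s t + (t + s) * Q s                                      ∎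
  where
  open ≡-Reasoning
  s : ℕ
  s = suc s′
  m : ℕ
  m = ⌊ s /2⌋
  shift : ∀ c → h s ((t + (s + s)) * c) ≡ h s (t * c) + (t + s) * (c * c)
  shift c = trans (cong (h s) (expand t s c)) (trans (h-shift s′ c (t * c)) (collect (h s (t * c)) t s c))
    where
    expand : ∀ t s c → (t + (s + s)) * c ≡ t * c + c * (s + s)
    expand = ℕ-Ring.solve-∀
    collect : ∀ a t s c → a + c * (t * c) + s * c * c ≡ a + (t + s) * (c * c)
    collect = ℕ-Ring.solve-∀

F-reflect : ∀ s t t′ → 0 < s → t + t′ ≡ s + s → F s t + s * Q s ≡ F s t′ + t * Q s
F-reflect (suc s′) t t′ _ t+t′≡2s = begin
  F s t + s * Q s                                           ≡⟨ cong₂ _+_ (F-by-rows s′ t) (sym (∑-* m s _)) ⟩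
  ∑ m (λ i → h s (t * gap s i)) + ∑ m (λ i → s * (gap s i * gap s i)) ≡⟨ sym (∑-+ m _ _) ⟩
  ∑ m (λ i → h s (t * gap s i) + s * (gap s i * gap s i))   ≡⟨ ∑-cong m (λ i → reflect (gap s i)) ⟩
  ∑ m (λ i → h s (t′ * gap s i) + t * (gap s i * gap s i))  ≡⟨ ∑-+ m _ _ ⟩
  ∑ m (λ i → h s (t′ * gap s i)) + ∑ m (λ i → t * (gap s i * gap s i))
    ≡⟨ cong₂ _+_ (sym (F-by-rows s′ t′)) (∑-* m t _) ⟩
  F s t′ + t * Q s                                          ∎
  where
  open ≡-Reasoning
  s : ℕ
  s = suc s′
  m : ℕ
  m = ⌊ s /2⌋
  reflect : ∀ c → h s (t * c) + s * (c * c) ≡ h s (t′ * c) + t * (c * c)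
  reflect c = trans (cong (_+_ (h s (t * c))) (sym (*-assoc s c c)))
                (trans (h-reflect s′ c (t * c) (t′ * c) tc+t′c≡)
                       (cong (_+_ (h s (t′ * c))) (swap t c)))
    where
    swap : ∀ t c → c * (t * c) ≡ t * (c * c)
    swap = ℕ-Ring.solve-∀
    tc+t′c≡ : t * c + t′ * c ≡ c * (s + s)
    tc+t′c≡ = trans (sym (*-distribʳ-+ c t t′)) (trans (cong (_* c) t+t′≡2s) (*-comm (s + s) c))

-- base case s = 1, where A has no rows
identity-one : ∀ t → Identity 1 t
identity-one t = check t
  where
  check : ∀ t → 24 * 0 + 1 * 1 + t * t ≡ 1 * 1 * t * t + 1
  check = ℕ-Ring.solve-∀

identity-sym : ∀ s t → Identity t s → Identity s t
identity-sym s t id-ts = begin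
  24 * F s t + s * s + t * t ≡⟨ cong (λ z → 24 * z + s * s + t * t) (F-sym s t) ⟩
  24 * F t s + s * s + t * t ≡⟨ swap₁ (F t s) s t ⟩
  24 * F t s + t * t + s * s ≡⟨ id-ts ⟩
  t * t * s * s + 1          ≡⟨ swap₂ s t ⟩
  s * s * t * t + 1          ∎
  where
  open ≡-Reasoning
  swap₁ : ∀ f s t → 24 * f + s * s + t * t ≡ 24 * f + t * t + s * s
  swap₁ = ℕ-Ring.solve-∀
  swap₂ : ∀ s t → t * t * s * s + 1 ≡ s * s * t * t + 1
  swap₂ = ℕ-Ring.solve-∀

identity-shift : ∀ s t → 0 < s → Identity s t → Identity s (t + (s + s))
identity-shift s t 0<s id-st = begin
  24 * F s (t + (s + s)) + s * s + (t + (s + s)) * (t + (s + s))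
    ≡⟨ cong (λ z → 24 * z + s * s + (t + (s + s)) * (t + (s + s))) (F-shift s t 0<s) ⟩
  24 * (F s t + (t + s) * Q s) + s * s + (t + (s + s)) * (t + (s + s))
    ≡⟨ split (F s t) (Q s) s t ⟩
  (24 * F s t + s * s + t * t) + 4 * (t + s) * (6 * Q s + s)
    ≡⟨ cong₂ (λ a b → a + 4 * (t + s) * b) id-st (Q-formula s) ⟩
  (s * s * t * t + 1) + 4 * (t + s) * (s * s * s)
    ≡⟨ collect s t ⟩
  s * s * (t + (s + s)) * (t + (s + s)) + 1 ∎
  where
  open ≡-Reasoning
  split : ∀ f q s t → 24 * (f + (t + s) * q) + s * s + (t + (s + s)) * (t + (s + s)) ≡
                     (24 * f + s * s + t * t) + 4 * (t + s) * (6 * q + s)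
  split = ℕ-Ring.solve-∀
  collect : ∀ s t → (s * s * t * t + 1) + 4 * (t + s) * (s * s * s) ≡ s * s * (t + (s + s)) * (t + (s + s)) + 1
  collect = ℕ-Ring.solve-∀

-- for s = d + t′, the identity passes from (s, t′) to (s, 2s - t′) = (s, s + d)
identity-reflect : ∀ d t′ → 0 < t′ → Identity (d + t′) t′ → Identity (d + t′) (d + t′ + d)
identity-reflect d t′ 0<t′ id-st′ = begin
  24 * F s t + s * s + t * t              ≡⟨ cong (λ z → 24 * z + s * s + t * t) F-st ⟩
  24 * (F s t′ + d * Q s) + s * s + t * t ≡⟨ split (F s t′) (Q s) d t′ ⟩
  (24 * F s t′ + s * s + t′ * t′) + 4 * d * (6 * Q s + s)
    ≡⟨ cong₂ (λ a b → a + 4 * d * b) id-st′ (Q-formula s) ⟩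
  (s * s * t′ * t′ + 1) + 4 * d * (s * s * s) ≡⟨ collect d t′ ⟩
  s * s * t * t + 1                       ∎
  where
  open ≡-Reasoning
  s t : ℕ
  s = d + t′
  t = d + t′ + d
  F-st : F s t ≡ F s t′ + d * Q s
  F-st = +-cancelʳ-≡ (s * Q s) _ _
    (trans (F-reflect s t t′ (≤-trans 0<t′ (m≤n+m t′ d)) (regroup₁ d t′)) (regroup₂ (F s t′) d t′ (Q s)))
    where
    regroup₁ : ∀ d t′ → d + t′ + d + t′ ≡ d + t′ + (d + t′)
    regroup₁ = ℕ-Ring.solve-∀
    regroup₂ : ∀ f d t′ q → f + (d + t′ + d) * q ≡ f + d * q + (d + t′) * q
    regroup₂ = ℕ-Ring.solve-∀
  split : ∀ f q d t′ → 24 * (f + d * q) + (d + t′) * (d + t′) + (d + t′ + d) * (d + t′ + d) ≡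
                       (24 * f + (d + t′) * (d + t′) + t′ * t′) + 4 * d * (6 * q + (d + t′))
  split = ℕ-Ring.solve-∀
  collect : ∀ d t′ → ((d + t′) * (d + t′) * t′ * t′ + 1) + 4 * d * ((d + t′) * (d + t′) * (d + t′)) ≡
                     (d + t′) * (d + t′) * (d + t′ + d) * (d + t′ + d) + 1
  collect = ℕ-Ring.solve-∀

coprime-∤ : ∀ {s t} → 1 < s → Coprime s t → ¬ (s ∣ t)
coprime-∤ 1<s cop s∣t = <⇒≢ 1<s (sym (cop (∣-refl , s∣t)))

-- one step of the subtractive Euclidean algorithm driving the induction
data EuclidStep (s t : ℕ) : Set where
  shift   : ∀ t′ → 0 < t′ → t ≡ t′ + (s + s) → EuclidStep s t
  reflect : ∀ d t′ → 0 < d → 0 < t′ → s ≡ d + t′ → t ≡ d + t′ + d → EuclidStep s t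

-- for coprime 1 < s ≤ t, t ≠ s and t ≠ 2s, so one of the two steps applies
euclid-step : ∀ s t → 1 < s → s ≤ t → Coprime s t → EuclidStep s t
euclid-step s t 1<s s≤t cop with m≤n⇒∃[o]m+o≡n s≤t
... | zero , refl = ⊥-elim (coprime-∤ 1<s cop (subst (s ∣_) (sym (+-identityʳ s)) ∣-refl))
... | suc d′ , refl with <-cmp (suc d′) s
...   | tri< d<s _ _ = reflect (suc d′) (s ∸ suc d′) z<s (m<n⇒0<n∸m d<s) s≡ (cong (_+ suc d′) s≡)
  where
  s≡ : s ≡ suc d′ + (s ∸ suc d′)
  s≡ = sym (m+[n∸m]≡n (<⇒≤ d<s))
...   | tri≈ _ d≡s _ = ⊥-elim (coprime-∤ 1<s cop (subst (λ d → s ∣ s + d) (sym d≡s) (∣m∣n⇒∣m+n ∣-refl ∣-refl)))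
...   | tri> _ _ s<d = shift (suc d′ ∸ s) (m<n⇒0<n∸m s<d) (trans (cong (_+_ s) (sym (m∸n+n≡m (<⇒≤ s<d)))) (regroup s _))
  where
  regroup : ∀ s k → s + (k + s) ≡ k + (s + s)
  regroup = ℕ-Ring.solve-∀

identity-step : ∀ s t → 1 < s → s ≤ t → Coprime s t →
  (∀ a b → a + b < s + t → 0 < a → 0 < b → Coprime a b → Identity a b) → Identity s t
identity-step s t 1<s s≤t cop smaller with euclid-step s t 1<s s≤t cop
... | shift t′ 0<t′ refl =
  identity-shift s t′ 0<s (smaller s t′ (+-monoʳ-< s (m<m+n t′ (≤-trans 0<s (m≤m+n s s)))) 0<s 0<t′ cop′)
  where
  0<s : 0 < s
  0<s = <-trans z<s 1<s
  cop′ : Coprime s t′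
  cop′ (c∣s , c∣t′) = cop (c∣s , ∣m∣n⇒∣m+n c∣t′ (∣m∣n⇒∣m+n c∣s c∣s))
... | reflect d t′ 0<d 0<t′ refl refl =
  identity-reflect d t′ 0<t′ (smaller (d + t′) t′ (+-monoʳ-< (d + t′) t′<t) (<-trans z<s 1<s) 0<t′ cop′)
  where
  t′<t : t′ < d + t′ + d
  t′<t = <-≤-trans (m<n+m t′ 0<d) (m≤m+n (d + t′) d)
  cop′ : Coprime (d + t′) t′
  cop′ {c} (c∣s , c∣t′) = cop (c∣s , ∣m∣n⇒∣m+n c∣s (∣m+n∣m⇒∣n (subst (c ∣_) (+-comm d t′) c∣s) c∣t′))

identity-ordered : ∀ s t → s ≤ t → 0 < s → Coprime s t →
  (∀ a b → a + b < s + t → 0 < a → 0 < b → Coprime a b → Identity a b) → Identity s t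
identity-ordered (suc zero)      t _   _ _   _       = identity-one t
identity-ordered s@(suc (suc _)) t s≤t _ cop smaller = identity-step s t (s≤s (s≤s z≤n)) s≤t cop smaller

identity : ∀ s t → 0 < s → 0 < t → Coprime s t → Identity s t
identity s t = bounded (suc (s + t)) s t ≤-refl
  where
  bounded : ∀ n s t → s + t < n → 0 < s → 0 < t → Coprime s t → Identity s t
  bounded (suc n) s t s+t<n 0<s 0<t cop with ≤-total s t
  ... | inj₁ s≤t = identity-ordered s t s≤t 0<s cop
                     (λ a b a+b< → bounded n a b (≤-trans a+b< (≤-pred s+t<n)))
  ... | inj₂ t≤s = identity-sym s t (identity-ordered t s t≤s 0<t (Coprimality.sym cop)
                     (λ a b a+b< → bounded n a b (≤-trans a+b< (≤-trans (≤-reflexive (+-comm t s)) (≤-pred s+t<n)))))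

⊖-shape : ∀ a b → (a ⊖ b ≡ + (a ∸ b) × b ∸ a ≡ 0)
                 ⊎ (Σ ℕ λ k → b ∸ a ≡ suc k × a ⊖ b ≡ -[1+ k ] × a ∸ b ≡ 0)
⊖-shape a b with ≤-total b a
... | inj₁ b≤a = inj₁ (ℤP.⊖-≥ b≤a , m≤n⇒m∸n≡0 b≤a)
... | inj₂ a≤b with b ∸ a in b∸a
...   | zero  = inj₁ (trans (ℤP.⊖-≤ a≤b) (trans (cong (λ z → ℤ.- + z) b∸a) (cong +_ (sym (m≤n⇒m∸n≡0 a≤b)))) , refl)
...   | suc k = inj₂ (k , refl , trans (ℤP.⊖-≤ a≤b) (cong (λ z → ℤ.- + z) b∸a) , m≤n⇒m∸n≡0 a≤b)

⊖≡+⇔ : ∀ a b v → 0 < v → (a ⊖ b ≡ + v) ⇔ (a ∸ b ≡ v)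
⊖≡+⇔ a b v 0<v with ⊖-shape a b
... | inj₁ (a⊖b , _) = mk⇔ (λ e → ℤP.+-injective (trans (sym a⊖b) e)) (λ e → trans a⊖b (cong +_ e))
... | inj₂ (k , _ , a⊖b , a∸b) = mk⇔ (λ e → ⊥-elim (-[1+]≢+ (trans (sym a⊖b) e)))
                                      (λ e → ⊥-elim (<⇒≢ 0<v (trans (sym a∸b) e)))
  where
  -[1+]≢+ : ∀ {k v} → -[1+ k ] ≢ + v
  -[1+]≢+ ()

⊖≡-⇔ : ∀ a b v → 0 < v → (a ⊖ b ≡ -[1+ v ∸ 1 ]) ⇔ (b ∸ a ≡ v)
⊖≡-⇔ a b v 0<v with ⊖-shape a b
... | inj₁ (a⊖b , b∸a) = mk⇔ (λ e → ⊥-elim (+≢-[1+] (trans (sym a⊖b) e)))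
                              (λ e → ⊥-elim (<⇒≢ 0<v (trans (sym b∸a) e)))
  where
  +≢-[1+] : ∀ {v k} → + v ≢ -[1+ k ]
  +≢-[1+] ()
⊖≡-⇔ a b (suc v) _ | inj₂ (k , b∸a , a⊖b , _) =
  mk⇔ (λ e → trans b∸a (cong suc (ℤP.-[1+-injective (trans (sym a⊖b) e))))
      (λ e → trans a⊖b (cong -[1+_] (suc-injective (trans (sym b∸a) e))))

∸-complement : ∀ a b → + (b ∸ a) ℤ.+ (a ⊖ b) ≡ + (a ∸ b)
∸-complement a b with ⊖-shape a b
... | inj₁ (a⊖b , b∸a) rewrite b∸a | a⊖b = ℤP.+-identityˡ _
... | inj₂ (k , b∸a , a⊖b , a∸b) rewrite b∸a | a⊖b | a∸b = ℤP.+-inverseʳ (+ suc k)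

/2≡⌊/2⌋ : ∀ s → s / 2 ≡ ⌊ s /2⌋
/2≡⌊/2⌋ zero          = refl
/2≡⌊/2⌋ (suc zero)    = refl
/2≡⌊/2⌋ (suc (suc s)) = trans (m/n≡1+[m∸n]/n {suc (suc s)} {2} (s≤s (s≤s z≤n))) (cong suc (/2≡⌊/2⌋ s))

odd<rows : ∀ s i → i < rows s → suc (i + i) < s
odd<rows s i i<rows = ≤-trans (subst (_≤ ⌊ s /2⌋ + ⌊ s /2⌋) (cong suc (+-suc i i)) (+-mono-≤ i<⌊s/2⌋ i<⌊s/2⌋)) halves≤s
  where
  i<⌊s/2⌋ : i < ⌊ s /2⌋
  i<⌊s/2⌋ = subst (i <_) (/2≡⌊/2⌋ s) i<rows
  halves≤s : ⌊ s /2⌋ + ⌊ s /2⌋ ≤ s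
  halves≤s = subst (⌊ s /2⌋ + ⌊ s /2⌋ ≤_) (⌊n/2⌋+⌈n/2⌉≡n s) (+-monoʳ-≤ ⌊ s /2⌋ (⌊n/2⌋≤⌈n/2⌉ s))

A≡⊖ : ∀ s t i j → A s t (suc i) (suc j) ≡ (s * t) ⊖ B s t i j
A≡⊖ s t i j = begin
  + (s * t) - (+ (2 * suc j ∸ 1) ℤ.* + s) - (+ (2 * suc i ∸ 1) ℤ.* + t)
    ≡⟨ cong₂ (λ x y → + (s * t) - (+ x ℤ.* + s) - (+ y ℤ.* + t)) (odd j) (odd i) ⟩
  + (s * t) - (+ suc (j + j) ℤ.* + s) - (+ suc (i + i) ℤ.* + t)
    ≡⟨ cong₂ (λ x y → + (s * t) - x - y) (sym (ℤP.pos-* (suc (j + j)) s)) (sym (ℤP.pos-* (suc (i + i)) t)) ⟩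
  + (s * t) - + (suc (j + j) * s) - + (suc (i + i) * t)
    ≡⟨ regroup (+ (s * t)) (+ (suc (j + j) * s)) (+ (suc (i + i) * t)) ⟩
  + (s * t) - (+ (suc (j + j) * s) ℤ.+ + (suc (i + i) * t))
    ≡⟨ cong (λ x → + (s * t) - x) (sym (ℤP.pos-+ (suc (j + j) * s) (suc (i + i) * t))) ⟩
  + (s * t) - + B s t i j
    ≡⟨ ℤP.m-n≡m⊖n (s * t) (B s t i j) ⟩
  (s * t) ⊖ B s t i j ∎
  where
  open ≡-Reasoning
  odd : ∀ j → 2 * suc j ∸ 1 ≡ suc (j + j)
  odd j = cong (_∸ 1) (double j)
    where
    double : ∀ j → 2 * suc j ≡ suc (suc (j + j))
    double = ℕ-Ring.solve-∀
  regroup : ∀ (x y z : ℤ) → x - y - z ≡ x - (y ℤ.+ z)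
  regroup = ℤ-Ring.solve-∀

multiple<⇒0 : ∀ {s k} → s ∣ k → k < s → k ≡ 0
multiple<⇒0 {k = zero}  _   _   = refl
multiple<⇒0 {k = suc k} s∣k k<s = ⊥-elim (<⇒≱ k<s (∣⇒≤ s∣k))

coprime-digit-≤ : ∀ {s t} → Coprime s t → ∀ a a′ b b′ → b ≤ b′ → b′ < s →
  a * s + b * t ≡ a′ * s + b′ * t → b ≡ b′
coprime-digit-≤ {s} {t} cop a a′ b b′ b≤b′ b′<s eq with m≤n⇒∃[o]m+o≡n b≤b′
... | k , refl = sym (trans (cong (_+_ b) k≡0) (+-identityʳ b))
  where
  as≡ : a * s ≡ a′ * s + k * t
  as≡ = +-cancelʳ-≡ (b * t) _ _ (trans eq (regroup a′ s b k t))
    where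
    regroup : ∀ a′ s b k t → a′ * s + (b + k) * t ≡ a′ * s + k * t + b * t
    regroup = ℕ-Ring.solve-∀
  s∣k : s ∣ k
  s∣k = coprime-divisor cop (subst (s ∣_) (*-comm k t) (∣m+n∣m⇒∣n (subst (s ∣_) as≡ (n∣m*n a)) (n∣m*n a′)))
  k≡0 : k ≡ 0
  k≡0 = multiple<⇒0 s∣k (≤-trans (s≤s (m≤n+m k b)) b′<s)

coprime-digit : ∀ {s t} → Coprime s t → ∀ a a′ b b′ → b < s → b′ < s →
  a * s + b * t ≡ a′ * s + b′ * t → b ≡ b′
coprime-digit cop a a′ b b′ b<s b′<s eq with ≤-total b b′
... | inj₁ b≤b′ = coprime-digit-≤ cop a a′ b b′ b≤b′ b′<s eq
... | inj₂ b′≤b = sym (coprime-digit-≤ cop a′ a b′ b b′≤b b<s (sym eq))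

double-injective : ∀ a b → a + a ≡ b + b → a ≡ b
double-injective a b eq = *-cancelˡ-≡ a b 2 (trans (twice a) (trans eq (sym (twice b))))
  where
  twice : ∀ a → 2 * a ≡ a + a
  twice = ℕ-Ring.solve-∀

B-injective : ∀ {s t} → Coprime s t → 0 < s → ∀ i j i′ j′ → i < rows s → i′ < rows s →
  B s t i j ≡ B s t i′ j′ → i ≡ i′ × j ≡ j′
B-injective {s} {t} cop 0<s i j i′ j′ i<m i′<m eq = i≡i′ , j≡j′
  where
  i≡i′ : i ≡ i′
  i≡i′ = double-injective i i′ (suc-injective
    (coprime-digit cop (suc (j + j)) (suc (j′ + j′)) _ _ (odd<rows s i i<m) (odd<rows s i′ i′<m) eq))
  j≡j′ : j ≡ j′
  j≡j′ = double-injective j j′ (suc-injective (*-cancelʳ-≡ _ _ s {{>-nonZero 0<s}}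
    (+-cancelʳ-≡ (suc (i + i) * t) _ _ (trans eq (cong (λ z → B s t z j′) (sym i≡i′))))))

-- two cells never have B-values summing to 2st, since (i + i′ + 1) t ≡ 0 mod s is impossible
B+B≢2st : ∀ {s t} → Coprime s t → ∀ i j i′ j′ → i < rows s → i′ < rows s →
  B s t i j + B s t i′ j′ ≢ s * t + s * t
B+B≢2st {s} {t} cop i j i′ j′ i<m i′<m eq = 0≢1+n (sym (coprime-digit cop (suc (j + j′)) t _ 0 q<s 0<s halved))
  where
  halved : suc (j + j′) * s + suc (i + i′) * t ≡ t * s + 0 * t
  halved = *-cancelˡ-≡ _ _ 2 (trans (sym (regroup₁ s t i j i′ j′)) (trans eq (regroup₂ s t)))
    where
    regroup₁ : ∀ s t i j i′ j′ → suc (j + j) * s + suc (i + i) * t + (suc (j′ + j′) * s + suc (i′ + i′) * t)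
                                ≡ 2 * (suc (j + j′) * s + suc (i + i′) * t)
    regroup₁ = ℕ-Ring.solve-∀
    regroup₂ : ∀ s t → s * t + s * t ≡ 2 * (t * s + 0 * t)
    regroup₂ = ℕ-Ring.solve-∀
  q<s : suc (i + i′) < s
  q<s = *-cancelˡ-< 2 _ _ (subst₂ _<_ (pair i i′) (twice s) (+-mono-< (odd<rows s i i<m) (odd<rows s i′ i′<m)))
    where
    pair : ∀ i i′ → suc (i + i) + suc (i′ + i′) ≡ 2 * suc (i + i′)
    pair = ℕ-Ring.solve-∀
    twice : ∀ s → s + s ≡ 2 * s
    twice = ℕ-Ring.solve-∀
  0<s : 0 < s
  0<s = ≤-trans z<s (odd<rows s i i<m)

∸-pos⇒≤ : ∀ {a b} → 0 < a ∸ b → b ≤ a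
∸-pos⇒≤ 0<a∸b = <⇒≤ (m∸n≢0⇒n<m (≢-sym (<⇒≢ 0<a∸b)))

∸-mirror : ∀ c x y → c ∸ x ≡ y ∸ c → 0 < c ∸ x → 0 < y ∸ c → x + y ≡ c + c
∸-mirror c x y eq 0<c∸x 0<y∸c = begin
  x + y             ≡⟨ cong (_+_ x) (sym (m∸n+n≡m c≤y)) ⟩
  x + ((y ∸ c) + c) ≡⟨ cong (λ z → x + (z + c)) (sym eq) ⟩
  x + ((c ∸ x) + c) ≡⟨ sym (+-assoc x (c ∸ x) c) ⟩
  x + (c ∸ x) + c   ≡⟨ cong (_+ c) (m+[n∸m]≡n x≤c) ⟩
  c + c             ∎
  where
  open ≡-Reasoning
  x≤c : x ≤ c
  x≤c = ∸-pos⇒≤ 0<c∸x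
  c≤y : c ≤ y
  c≤y = ∸-pos⇒≤ 0<y∸c

∑ℤ : ℕ → (ℕ → ℤ) → ℤ
∑ℤ zero    f = + 0
∑ℤ (suc k) f = f 0 ℤ.+ ∑ℤ k (λ i → f (suc i))

sumℤ-applyUpTo : ∀ k (g : ℕ → ℤ) (f : ℕ → ℕ) → sumℤ (map g (applyUpTo f k)) ≡ ∑ℤ k (λ i → g (f i))
sumℤ-applyUpTo zero    g f = refl
sumℤ-applyUpTo (suc k) g f = cong (ℤ._+_ (g (f 0))) (sumℤ-applyUpTo k g (λ i → f (suc i)))

∑ℤ-cong : ∀ k {f g : ℕ → ℤ} → (∀ i → f i ≡ g i) → ∑ℤ k f ≡ ∑ℤ k g
∑ℤ-cong zero    eq = refl
∑ℤ-cong (suc k) eq = cong₂ ℤ._+_ (eq 0) (∑ℤ-cong k (λ i → eq (suc i)))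

∑ℤ-+ : ∀ k (f g : ℕ → ℤ) → ∑ℤ k (λ i → f i ℤ.+ g i) ≡ ∑ℤ k f ℤ.+ ∑ℤ k g
∑ℤ-+ zero    f g = refl
∑ℤ-+ (suc k) f g = trans (cong (ℤ._+_ (f 0 ℤ.+ g 0)) (∑ℤ-+ k (λ i → f (suc i)) (λ i → g (suc i))))
                         (exchange (f 0) (g 0) _ _)
  where
  exchange : ∀ (a b c d : ℤ) → (a ℤ.+ b) ℤ.+ (c ℤ.+ d) ≡ (a ℤ.+ c) ℤ.+ (b ℤ.+ d)
  exchange = ℤ-Ring.solve-∀

∑ℤ-pos : ∀ k (f : ℕ → ℕ) → ∑ℤ k (λ i → + f i) ≡ + ∑ k f
∑ℤ-pos zero    f = refl
∑ℤ-pos (suc k) f = trans (cong (ℤ._+_ (+ f 0)) (∑ℤ-pos k (λ i → f (suc i)))) (sym (ℤP.pos-+ (f 0) _))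

∑∑ℤ-pos : ∀ k l (f : ℕ → ℕ → ℕ) → ∑ℤ k (λ i → ∑ℤ l (λ j → + f i j)) ≡ + ∑ k (λ i → ∑ l (f i))
∑∑ℤ-pos k l f = trans (∑ℤ-cong k (λ i → ∑ℤ-pos l (f i))) (∑ℤ-pos k _)

module Cells (s t : ℕ) (P : List Step) where

  m n : ℕ
  m = rows s
  n = cols t

  isAbove : ℕ → ℕ → Bool
  isAbove i j = above m P (suc i) (suc j)

  -- |A_{i+1,j+1}| if this entry contributes to M_A(P), and 0 otherwise
  contribution : ℕ → ℕ → ℕ
  contribution i j = if isAbove i j then B s t i j ∸ s * t else s * t ∸ B s t i j

  contribution-above : ∀ {i j} → isAbove i j ≡ true → contribution i j ≡ B s t i j ∸ s * t
  contribution-above e rewrite e = refl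

  contribution-below : ∀ {i j} → isAbove i j ≡ false → contribution i j ≡ s * t ∸ B s t i j
  contribution-below e rewrite e = refl

  N : ℕ
  N = suc (s * t + t * s)

  contribution< : ∀ i j → i < m → j < n → contribution i j < N
  contribution< i j i<m j<n with isAbove i j
  ... | true  = s≤s (≤-trans (m∸n≤m (B s t i j) (s * t)) B≤)
    where
    B≤ : B s t i j ≤ s * t + t * s
    B≤ = subst (B s t i j ≤_) (+-comm (t * s) (s * t))
           (+-mono-≤ (*-monoˡ-≤ s (<⇒≤ (odd<rows t j j<n))) (*-monoˡ-≤ t (<⇒≤ (odd<rows s i i<m))))
  ... | false = s≤s (≤-trans (m∸n≤m (s * t) (B s t i j)) (m≤m+n (s * t) (t * s)))

  InM⇒contribution : ∀ v → 0 < v → InM s t P v → Σ ℕ λ i → Σ ℕ λ j → i < m × j < n × contribution i j ≡ v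
  InM⇒contribution v 0<v (suc i , suc j , (_ , i<m , _ , j<n) , inj₁ (is-above , A≡ , _)) =
    i , j , i<m , j<n ,
    trans (contribution-above (Equivalence.to T-≡ is-above)) (Equivalence.to (⊖≡-⇔ (s * t) (B s t i j) v 0<v) (trans (sym (A≡⊖ s t i j)) A≡))
  InM⇒contribution v 0<v (suc i , suc j , (_ , i<m , _ , j<n) , inj₂ (is-below , A≡ , _)) =
    i , j , i<m , j<n ,
    trans (contribution-below (Equivalence.to T-not-≡ is-below)) (Equivalence.to (⊖≡+⇔ (s * t) (B s t i j) v 0<v) (trans (sym (A≡⊖ s t i j)) A≡))

  contribution⇒InM : ∀ v i j → 0 < v → i < m → j < n → contribution i j ≡ v → InM s t P v
  contribution⇒InM v i j 0<v i<m j<n eq =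
    suc i , suc j , (s≤s z≤n , i<m , s≤s z≤n , j<n) , side (isAbove i j) refl
    where
    side : ∀ b → isAbove i j ≡ b →
      (T (isAbove i j) × A s t (suc i) (suc j) ≡ -[1+ v ∸ 1 ] × 0 < v)
      ⊎ (T (not (isAbove i j)) × A s t (suc i) (suc j) ≡ + v × 0 < v)
    side true  e = inj₁ (Equivalence.from T-≡ e , trans (A≡⊖ s t i j)
      (Equivalence.from (⊖≡-⇔ (s * t) (B s t i j) v 0<v) (trans (sym (contribution-above e)) eq)) , 0<v)
    side false e = inj₂ (Equivalence.from T-not-≡ e , trans (A≡⊖ s t i j)
      (Equivalence.from (⊖≡+⇔ (s * t) (B s t i j) v 0<v) (trans (sym (contribution-below e)) eq)) , 0<v)

  contribution-injective : Coprime s t → 0 < s → ∀ v i j i′ j′ → i < m → i′ < m → 0 < v →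
    contribution i j ≡ v → contribution i′ j′ ≡ v → i ≡ i′ × j ≡ j′
  contribution-injective cop 0<s v i j i′ j′ i<m i′<m 0<v c≡v c′≡v = sides (isAbove i j) (isAbove i′ j′) refl refl
    where
    st Bᵢⱼ B′ : ℕ
    st  = s * t
    Bᵢⱼ = B s t i j
    B′  = B s t i′ j′
    positive : ∀ {x} → x ≡ v → 0 < x
    positive x≡v = subst (0 <_) (sym x≡v) 0<v
    mixed : ∀ x y → st ∸ x ≡ v → y ∸ st ≡ v → x + y ≡ st + st
    mixed x y x≡ y≡ = ∸-mirror st x y (trans x≡ (sym y≡)) (positive x≡) (positive y≡)
    sides : ∀ b b′ → isAbove i j ≡ b → isAbove i′ j′ ≡ b′ → i ≡ i′ × j ≡ j′
    sides false false e e′ = B-injective cop 0<s i j i′ j′ i<m i′<m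
      (∸-cancelˡ-≡ (∸-pos⇒≤ (positive below)) (∸-pos⇒≤ (positive below′)) (trans below (sym below′)))
      where
      below  : st ∸ Bᵢⱼ ≡ v
      below  = trans (sym (contribution-below e)) c≡v
      below′ : st ∸ B′ ≡ v
      below′ = trans (sym (contribution-below e′)) c′≡v
    sides true true e e′ = B-injective cop 0<s i j i′ j′ i<m i′<m
      (∸-cancelʳ-≡ {o = st} (∸-pos⇒≤ (positive over)) (∸-pos⇒≤ (positive over′)) (trans over (sym over′)))
      where
      over  : Bᵢⱼ ∸ st ≡ v
      over  = trans (sym (contribution-above e)) c≡v
      over′ : B′ ∸ st ≡ v
      over′ = trans (sym (contribution-above e′)) c′≡v
    sides false true e e′ = ⊥-elim (B+B≢2st cop i j i′ j′ i<m i′<m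
      (mixed Bᵢⱼ B′ (trans (sym (contribution-below e)) c≡v) (trans (sym (contribution-above e′)) c′≡v)))
    sides true false e e′ = ⊥-elim (B+B≢2st cop i′ j′ i j i′<m i<m
      (mixed B′ Bᵢⱼ (trans (sym (contribution-below e′)) c′≡v) (trans (sym (contribution-above e)) c≡v)))

  -- contribution = A⁺ - [above]·A, summed over the grid
  ∑contribution+sumAbove : + ∑ m (λ i → ∑ n (contribution i)) ℤ.+ sumAbove s t P ≡ + F s t
  ∑contribution+sumAbove = begin
    + ∑ m (λ i → ∑ n (contribution i)) ℤ.+ sumAbove s t P
      ≡⟨ cong₂ ℤ._+_ (sym (∑∑ℤ-pos m n contribution)) sumAbove≡ ⟩
    ∑ℤ m (λ i → ∑ℤ n (λ j → + contribution i j)) ℤ.+ ∑ℤ m (λ i → ∑ℤ n (aboveEntry i))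
      ≡⟨ sym (∑ℤ-+ m _ _) ⟩
    ∑ℤ m (λ i → ∑ℤ n (λ j → + contribution i j) ℤ.+ ∑ℤ n (aboveEntry i))
      ≡⟨ ∑ℤ-cong m (λ i → trans (sym (∑ℤ-+ n _ _)) (∑ℤ-cong n (λ j → cell i j))) ⟩
    ∑ℤ m (λ i → ∑ℤ n (λ j → + (s * t ∸ B s t i j)))
      ≡⟨ ∑∑ℤ-pos m n (λ i j → s * t ∸ B s t i j) ⟩
    + ∑ m (λ i → ∑ n (λ j → s * t ∸ B s t i j))
      ≡⟨ cong₂ (λ a b → + ∑ a (λ i → ∑ b (λ j → s * t ∸ B s t i j))) (/2≡⌊/2⌋ s) (/2≡⌊/2⌋ t) ⟩
    + F s t ∎
    where
    open ≡-Reasoning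
    aboveEntry : ℕ → ℕ → ℤ
    aboveEntry i j = if isAbove i j then A s t (suc i) (suc j) else + 0
    sumAbove≡ : sumAbove s t P ≡ ∑ℤ m (λ i → ∑ℤ n (aboveEntry i))
    sumAbove≡ = trans (sumℤ-applyUpTo m _ (λ i → i)) (∑ℤ-cong m (λ i → sumℤ-applyUpTo n _ (λ j → j)))
    cell : ∀ i j → + contribution i j ℤ.+ aboveEntry i j ≡ + (s * t ∸ B s t i j)
    cell i j = side (isAbove i j) refl
      where
      side : ∀ b → isAbove i j ≡ b → + contribution i j ℤ.+ aboveEntry i j ≡ + (s * t ∸ B s t i j)
      side true  e rewrite e = trans (cong (λ a → + (B s t i j ∸ s * t) ℤ.+ a) (A≡⊖ s t i j)) (∸-complement (s * t) (B s t i j))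
      side false e rewrite e = ℤP.+-identityʳ _

∑∑-by-values : ∀ m n N (g : ℕ → ℕ → ℕ) → (∀ i j → i < m → j < n → g i j < N) →
  ∑ m (λ i → ∑ n (g i)) ≡ ∑ N (λ v → v * ∑ m (λ i → mult n (g i) v))
∑∑-by-values m n N g bound = begin
  ∑ m (λ i → ∑ n (g i))                       ≡⟨ ∑-cong< m (λ i i<m → ∑-by-values n N (g i) (λ j j<n → bound i j i<m j<n)) ⟩
  ∑ m (λ i → ∑ N (λ v → v * mult n (g i) v))  ≡⟨ ∑-swap m N _ ⟩
  ∑ N (λ v → ∑ m (λ i → v * mult n (g i) v))  ≡⟨ ∑-cong N (λ v → ∑-* m v _) ⟩
  ∑ N (λ v → v * ∑ m (λ i → mult n (g i) v))  ∎
  where open ≡-Reasoning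

∑-values-cong : ∀ N (a b : ℕ → ℕ) → (∀ v → 0 < v → a v ≡ b v) → ∑ N (λ v → v * a v) ≡ ∑ N (λ v → v * b v)
∑-values-cong N a b eq = ∑-cong N same
  where
  same : ∀ v → v * a v ≡ v * b v
  same zero    = refl
  same (suc v) = cong (suc v *_) (eq (suc v) z<s)

-- Under the hypotheses of the theorem the diagonal hooks of λ and the
-- contributions of the cells have the same positive values, each occurring
-- once, so their sums agree.
module Matching (s t : ℕ) (0<s : 0 < s) (cop : Coprime s t) (P : List Step)
                (lam : List ℕ) (dec : Decreasing lam) (sc : SelfConjugate lam)
                (hooks≡M : ∀ h → DiagHook lam h ⇔ InM s t P h) where

  open Cells s t P
  open SelfConjugatePartition lam dec sc

  onDiagonal : ∀ r v → 0 < v → diagHook r ≡ v → r < p r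
  onDiagonal r v 0<v d≡v with r <? p r
  ... | yes r<p = r<p
  ... | no  r≮p = ⊥-elim (<⇒≢ 0<v (trans (sym (diagHook-off r r≮p)) d≡v))

  diagHook-pos : ∀ r → r < p r → 0 < diagHook r
  diagHook-pos r r<p = subst (0 <_) (sym (diagHook-hook r r<p)) z<s

  hook⇒cell : ∀ v → 0 < v → (Σ ℕ λ r → r < p r × diagHook r ≡ v) →
    Σ ℕ λ i → Σ ℕ λ j → i < m × j < n × contribution i j ≡ v
  hook⇒cell v 0<v (r , r<p , d≡v) =
    InM⇒contribution v 0<v (Equivalence.to (hooks≡M v) (r , r<p , trans (sym (diagHook-hook r r<p)) d≡v))

  cell⇒hook : ∀ v → 0 < v → (Σ ℕ λ i → Σ ℕ λ j → i < m × j < n × contribution i j ≡ v) →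
    Σ ℕ λ r → r < p r × diagHook r ≡ v
  cell⇒hook v 0<v (i , j , i<m , j<n , c≡v) with Equivalence.from (hooks≡M v) (contribution⇒InM v i j 0<v i<m j<n c≡v)
  ... | r , r<p , hook≡v = r , r<p , trans (diagHook-hook r r<p) hook≡v

  -- every diagonal hook is a contribution, hence below N
  diagHook< : ∀ r → r < ℓ → diagHook r < N
  diagHook< r _ with r <? p r
  ... | yes r<p with hook⇒cell (diagHook r) (diagHook-pos r r<p) (r , r<p , refl)
  ...   | i , j , i<m , j<n , c≡d = subst (_< N) c≡d (contribution< i j i<m j<n)
  diagHook< r _ | no r≮p = subst (_< N) (sym (diagHook-off r r≮p)) z<s

  hookCount gridCount : ℕ → ℕ
  hookCount v = mult ℓ diagHook v
  gridCount v = ∑ m (λ i → mult n (contribution i) v)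

  hookCount≤1 : ∀ v → 0 < v → hookCount v ≤ 1
  hookCount≤1 v 0<v = ∑-atMostOne ℓ _ (λ r _ → 𝟙≤1 _) λ r r′ _ _ q q′ →
    let d≡v  = ≡ᵇ⇒≡ (diagHook r) v (𝟙-pos q)
        d′≡v = ≡ᵇ⇒≡ (diagHook r′) v (𝟙-pos q′)
    in diagHook-injective r r′ (onDiagonal r v 0<v d≡v) (onDiagonal r′ v 0<v d′≡v) (trans d≡v (sym d′≡v))

  gridCount≤1 : ∀ v → 0 < v → gridCount v ≤ 1
  gridCount≤1 v 0<v = ∑-atMostOne m (λ i → mult n (contribution i) v) row≤1 sameRow
    where
    same : ∀ {i j i′ j′} → i < m → i′ < m → contribution i j ≡ v → contribution i′ j′ ≡ v → i ≡ i′ × j ≡ j′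
    same {i} {j} {i′} {j′} i<m i′<m = contribution-injective cop 0<s v i j i′ j′ i<m i′<m 0<v
    row≤1 : ∀ i → i < m → mult n (contribution i) v ≤ 1
    row≤1 i i<m = ∑-atMostOne n _ (λ _ _ → 𝟙≤1 _) λ j j′ _ _ q q′ →
      proj₂ (same i<m i<m (≡ᵇ⇒≡ _ v (𝟙-pos q)) (≡ᵇ⇒≡ _ v (𝟙-pos q′)))
    sameRow : ∀ i i′ → i < m → i′ < m → 0 < mult n (contribution i) v → 0 < mult n (contribution i′) v → i ≡ i′
    sameRow i i′ i<m i′<m q q′ with mult-pos⇒ n (contribution i) v q | mult-pos⇒ n (contribution i′) v q′
    ... | j , _ , c≡v | j′ , _ , c′≡v = proj₁ (same i<m i′<m c≡v c′≡v)

  counts-agree : ∀ v → 0 < v → hookCount v ≡ gridCount v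
  counts-agree v 0<v = ≤1-≡ _ _ (hookCount≤1 v 0<v) (gridCount≤1 v 0<v) hook⇒grid grid⇒hook
    where
    hook⇒grid : 0 < hookCount v → 0 < gridCount v
    hook⇒grid q with mult-pos⇒ ℓ diagHook v q
    ... | r , _ , d≡v with hook⇒cell v 0<v (r , onDiagonal r v 0<v d≡v , d≡v)
    ...   | i , j , i<m , j<n , c≡v = ∑-pos m _ i i<m (⇒mult-pos n (contribution i) v j j<n c≡v)
    grid⇒hook : 0 < gridCount v → 0 < hookCount v
    grid⇒hook q with ∑-pos⇒ m _ q
    ... | i , i<m , q′ with mult-pos⇒ n (contribution i) v q′
    ...   | j , j<n , c≡v with cell⇒hook v 0<v (i , j , i<m , j<n , c≡v)
    ...     | r , r<p , d≡v = ⇒mult-pos ℓ diagHook v r (p-pos⇒<ℓ r (≤-<-trans z≤n r<p)) d≡v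

  size≡∑contribution : size lam ≡ ∑ m (λ i → ∑ n (contribution i))
  size≡∑contribution = begin
    size lam                           ≡⟨ size≡∑diagHook ⟩
    ∑ ℓ diagHook                       ≡⟨ ∑-by-values ℓ N diagHook diagHook< ⟩
    ∑ N (λ v → v * hookCount v)        ≡⟨ ∑-values-cong N hookCount gridCount counts-agree ⟩
    ∑ N (λ v → v * gridCount v)        ≡⟨ sym (∑∑-by-values m n N contribution contribution<) ⟩
    ∑ m (λ i → ∑ n (contribution i))   ∎
    where open ≡-Reasoning

identityℤ : ∀ s t → Identity s t → + (24 * F s t) ≡ (+ (s * s) - + 1) ℤ.* (+ (t * t) - + 1)
identityℤ s t id-st = solve (+ (24 * F s t)) (+ (s * s)) (+ (t * t)) lifted
  where
  solve : ∀ (f a b : ℤ) → f ℤ.+ a ℤ.+ b ≡ a ℤ.* b ℤ.+ + 1 → f ≡ (a - + 1) ℤ.* (b - + 1)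
  solve f a b eq = begin
    f                                  ≡⟨ expand₁ f a b ⟩
    (f ℤ.+ a ℤ.+ b) - a - b            ≡⟨ cong (λ z → z - a - b) eq ⟩
    (a ℤ.* b ℤ.+ + 1) - a - b          ≡⟨ expand₂ a b ⟩
    (a - + 1) ℤ.* (b - + 1)            ∎
    where
    open ≡-Reasoning
    expand₁ : ∀ f a b → f ≡ (f ℤ.+ a ℤ.+ b) - a - b
    expand₁ = ℤ-Ring.solve-∀
    expand₂ : ∀ a b → (a ℤ.* b ℤ.+ + 1) - a - b ≡ (a - + 1) ℤ.* (b - + 1)
    expand₂ = ℤ-Ring.solve-∀
  lifted : + (24 * F s t) ℤ.+ + (s * s) ℤ.+ + (t * t) ≡ + (s * s) ℤ.* + (t * t) ℤ.+ + 1
  lifted = begin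
    + (24 * F s t) ℤ.+ + (s * s) ℤ.+ + (t * t)  ≡⟨ cong (ℤ._+ + (t * t)) (sym (ℤP.pos-+ (24 * F s t) (s * s))) ⟩
    + (24 * F s t + s * s) ℤ.+ + (t * t)        ≡⟨ sym (ℤP.pos-+ (24 * F s t + s * s) (t * t)) ⟩
    + (24 * F s t + s * s + t * t)              ≡⟨ cong +_ (trans id-st (cong (_+ 1) (*-assoc (s * s) t t))) ⟩
    + ((s * s) * (t * t) + 1)                   ≡⟨ ℤP.pos-+ ((s * s) * (t * t)) 1 ⟩
    + ((s * s) * (t * t)) ℤ.+ + 1               ≡⟨ cong (ℤ._+ + 1) (ℤP.pos-* (s * s) (t * t)) ⟩
    + (s * s) ℤ.* + (t * t) ℤ.+ + 1             ∎
    where open ≡-Reasoning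

scale-difference : ∀ (g x : ℤ) → + 24 ℤ.* g ≡ + 24 ℤ.* (g ℤ.+ x) - + 24 ℤ.* x
scale-difference = ℤ-Ring.solve-∀

lemma2p3 : (s t : ℕ) → 0 < s → 0 < t → Coprime s t →
    (P : List Step) → IsLatticePath (rows s) (cols t) P →
    (lam : List ℕ) → IsPartition lam → SelfConjugate lam →
    (∀ h → DiagHook lam h ⇔ InM s t P h) →
    + (24 * size lam) ≡ (+ (s * s) - + 1) ℤ.* (+ (t * t) - + 1) - + 24 ℤ.* sumAbove s t P
lemma2p3 s t 0<s 0<t cop P _ lam (dec , _) sc hooks≡M = begin
  + (24 * size lam)                           ≡⟨ cong (λ z → + (24 * z)) size≡∑contribution ⟩
  + (24 * G)                                  ≡⟨ ℤP.pos-* 24 G ⟩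
  + 24 ℤ.* + G                                ≡⟨ scale-difference (+ G) (sumAbove s t P) ⟩
  + 24 ℤ.* (+ G ℤ.+ sumAbove s t P) - + 24 ℤ.* sumAbove s t P
    ≡⟨ cong (λ z → + 24 ℤ.* z - + 24 ℤ.* sumAbove s t P) ∑contribution+sumAbove ⟩
  + 24 ℤ.* + F s t - + 24 ℤ.* sumAbove s t P  ≡⟨ cong (_- + 24 ℤ.* sumAbove s t P) (sym (ℤP.pos-* 24 (F s t))) ⟩
  + (24 * F s t) - + 24 ℤ.* sumAbove s t P    ≡⟨ cong (_- + 24 ℤ.* sumAbove s t P) (identityℤ s t (identity s t 0<s 0<t cop)) ⟩
  (+ (s * s) - + 1) ℤ.* (+ (t * t) - + 1) - + 24 ℤ.* sumAbove s t P ∎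
  where
  open ≡-Reasoning
  open Cells s t P
  open Matching s t 0<s cop P lam dec sc hooks≡M
  G : ℕ
  G = ∑ m (λ i → ∑ n (contribution i))
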